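{- Let $G$ be a connected bipartite graph with color classes $E$ and $V$, and let $\Gamma$ be a spanning tree of $G$ inducing the hypertree $\mathbf f$ of $(V,E)$. For each edge $\varepsilon=ve$ of $\Gamma$ ($v\in V$, $e\in E$), let $w(\varepsilon)$ be the number of elements of $E$ lying in the connected component of $\Gamma\setminus\{\varepsilon\}$ that contains $e$, divided by $|E|$. Then for each $v\in V$ the weights on the edges of $\Gamma$ at $v$ are nonnegative and sum to $1$, and \[\sum_{\varepsilon=ve\in\Gamma}w(\varepsilon)\,\mathbf i_{\{e\}}=\mathbf f+\frac1{|E|}\mathbf i_E .\] That is, these weights are the coordinates of the point $\mathbf f^+=\mathbf f+\frac1{|E|}\mathbf i_E$ of $M_\Gamma$ in the direct sum decomposition $M_\Gamma=\sum_{v\in V}\Delta_v^\Gamma$.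
   Context: A hypertree induced by $\Gamma$ is the function $\mathbf f\colon E\to\mathbb N$ with $\mathbf f(e)+1=\deg_\Gamma(e)$. $\mathbf i_{\{e\}}$ is the standard basis vector of $\mathbb R^E$ and $\mathbf i_E$ the all-ones vector. For $v\in V$, $\Delta_v^\Gamma=\operatorname{conv}\{\mathbf i_{\{e\}}: ev\in\Gamma\}$, and $M_\Gamma=\sum_{v\in V}\Delta^\Gamma_v$ (Minkowski sum), which is a direct sum: every point of $M_\Gamma$ is uniquely $\sum_{v}\sum_{ve\in\Gamma}w(ve)\mathbf i_{\{e\}}$ with weights $w\ge0$ summing to $1$ at each $v$. -}

module Defs where

open import Data.Nat using (ℕ; zero; suc)
open import Data.Fin using (Fin; zero; suc; _≟_)
open import Data.Bool using (Bool; true; false; _∧_; not; if_then_else_)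
open import Data.Sum using (_⊎_; inj₁; inj₂)
open import Data.Product using (Σ; _×_)
open import Data.List using (List; length)
open import Data.List.Membership.Propositional using (_∈_)
open import Data.List.Relation.Unary.Unique.Propositional using (Unique)
open import Relation.Nullary using (¬_)
open import Relation.Nullary.Decidable using (⌊_⌋)
open import Relation.Binary.PropositionalEquality using (_≡_)
open import Relation.Binary.Construct.Closure.ReflexiveTransitive using (Star)
open import Function.Bundles using (_⇔_)
open import Data.Rational as ℚ using (ℚ; 0ℚ)

-- A bipartite graph with colour classes V = Fin m and E = Fin n (simple graph):
-- BGraph m n v e = true iff ve is an edge.
BGraph : ℕ → ℕ → Set
BGraph m n = Fin m → Fin n → Bool

Vtx : ℕ → ℕ → Set
Vtx m n = Fin m ⊎ Fin n

data Adj {m n : ℕ} (H : BGraph m n) : Vtx m n → Vtx m n → Set where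
  ve : ∀ v e → H v e ≡ true → Adj H (inj₁ v) (inj₂ e)
  ev : ∀ v e → H v e ≡ true → Adj H (inj₂ e) (inj₁ v)

Reach : {m n : ℕ} → BGraph m n → Vtx m n → Vtx m n → Set
Reach H = Star (Adj H)

Connected : {m n : ℕ} → BGraph m n → Set
Connected H = ∀ x y → Reach H x y

removeEdge : {m n : ℕ} → BGraph m n → Fin m → Fin n → BGraph m n
removeEdge H v0 e0 v e = H v e ∧ not (⌊ v ≟ v0 ⌋ ∧ ⌊ e ≟ e0 ⌋)

-- Tree: connected and acyclic, acyclicity expressed as "every edge is a
-- bridge" (removing edge ve disconnects v from e).
IsTree : {m n : ℕ} → BGraph m n → Set
IsTree H = Connected H ×
  (∀ v e → H v e ≡ true → ¬ Reach (removeEdge H v e) (inj₁ v) (inj₂ e))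

Subgraph : {m n : ℕ} → BGraph m n → BGraph m n → Set
Subgraph Γ G = ∀ v e → Γ v e ≡ true → G v e ≡ true

-- Γ is a spanning tree of G (all vertices V ⊎ E are present by construction).
SpanningTree : {m n : ℕ} → BGraph m n → BGraph m n → Set
SpanningTree Γ G = Subgraph Γ G × IsTree Γ

HasCard : {n : ℕ} → (Fin n → Set) → ℕ → Set
HasCard {n} P k =
  Σ (List (Fin n)) λ l → Unique l × (∀ x → (x ∈ l) ⇔ P x) × length l ≡ k

sumℕ : {k : ℕ} → (Fin k → ℕ) → ℕ
sumℕ {zero} f = 0
sumℕ {suc k} f = f zero Data.Nat.+ sumℕ (λ i → f (suc i))

sumℚ : {k : ℕ} → (Fin k → ℚ) → ℚ
sumℚ {zero} f = 0ℚ
sumℚ {suc k} f = f zero ℚ.+ sumℚ (λ i → f (suc i))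

degE : {m n : ℕ} → BGraph m n → Fin n → ℕ
degE Γ e = sumℕ (λ v → if Γ v e then 1 else 0)

-- Every element e′ of E lies in exactly one branch of the tree Γ at a vertex v ∈ V,
-- namely the one entered by the first edge of the path from v to e′; so the
-- branch sizes at v add up to |E|. At e ∈ E, the branch through the edge ve misses
-- e′ exactly when ve is the first edge of the path from e to e′: e itself lies in
-- all deg e branches at e and every other e′ in deg e − 1 of them, so the branch
-- sizes at e add up to |E| (deg e − 1) + 1. Both facts rest on ve being a bridge:
-- v and e are disconnected in Γ ∖ ve.

module Submission where

open import Defs
open import Level using (Level; 0ℓ)
open import Data.Nat as ℕ using (ℕ; NonZero; zero; suc)
import Data.Nat.Properties as ℕ
open import Data.Nat.Tactic.RingSolver using (solve-∀)
open import Data.Fin using (Fin; zero; suc)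
open import Data.Fin.Properties using (_≟_)
open import Data.Bool using (Bool; true; false; if_then_else_; T?)
open import Data.Bool.Properties using (T-≡)
open import Data.Sum using (_⊎_; inj₁; inj₂)
open import Data.Sum.Properties using (≡-dec; inj₂-injective)
open import Data.Product using (_×_; _,_; proj₁; proj₂; ∃-syntax)
open import Data.Empty using (⊥-elim)
open import Data.List using (List; []; _∷_; length)
open import Data.List.Relation.Unary.Unique.Propositional using (Unique)
open import Data.List.Relation.Unary.AllPairs using ([]; _∷_)
open import Data.List.Relation.Unary.All as All using ()
open import Data.List.Relation.Unary.Any using (here; there)
open import Data.List.Membership.Propositional using (_∈_)
import Data.List.Membership.DecPropositional as DecMembership
open import Data.Integer as ℤ using (ℤ; +_)
import Data.Integer.Properties as ℤ
import Data.Integer.Tactic.RingSolver as ℤ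
open import Data.Rational as ℚ using (ℚ; _/_; _≤_; _+_; _-_; 0ℚ; 1ℚ)
import Data.Rational.Properties as ℚ
open import Data.Rational.Solver using (module +-*-Solver)
open import Data.Rational.Unnormalised as ℚᵘ using (mkℚᵘ; *≡*)
import Data.Rational.Unnormalised.Properties as ℚᵘ
open import Function using (_∘_)
open import Function.Bundles using (_⇔_; mk⇔)
open import Relation.Nullary using (Dec; yes; no; does; ¬_)
open import Relation.Nullary.Decidable using (map; map′; does-⇔; dec-false)
open import Relation.Unary using (Pred; Decidable; _⊆_)
open import Relation.Binary using (Rel)
open import Relation.Binary.PropositionalEquality
  using (_≡_; _≢_; refl; sym; trans; cong; cong₂; module ≡-Reasoning)
open import Relation.Binary.Construct.Closure.ReflexiveTransitive
  using (Star; ε; _◅_; _◅◅_; reverse) renaming (map to mapStar)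
open import Algebra.Properties.CommutativeMonoid.Sum ℕ.+-0-commutativeMonoid
  using (sum; sum-cong-≗; ∑-distrib-+; ∑-comm)

private
  variable
    k c : ℕ
    p q : Level
    P : Pred (Fin k) p
    Q : Pred (Fin k) q

sumℕ≡sum : (f : Fin k → ℕ) → sumℕ f ≡ sum f
sumℕ≡sum {zero} f = refl
sumℕ≡sum {suc k} f = cong (f zero ℕ.+_) (sumℕ≡sum (f ∘ suc))

sum-const : ∀ k c → sum {k} (λ _ → c) ≡ k ℕ.* c
sum-const zero c = refl
sum-const (suc k) c = cong (c ℕ.+_) (sum-const k c)

indicator : ∀ {a} {A : Set a} → Dec A → ℕ
indicator a? = if does a? then 1 else 0

count : Decidable P → ℕ
count P? = sum (indicator ∘ P?)

count-cong : (∀ i → P i ⇔ Q i) → (P? : Decidable P) (Q? : Decidable Q) → count P? ≡ count Q?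
count-cong P⇔Q P? Q? = sum-cong-≗ (λ i → cong (if_then 1 else 0) (does-⇔ (P⇔Q i) (P? i) (Q? i)))

count-empty : {P : Pred (Fin k) p} → (∀ i → ¬ P i) → (P? : Decidable P) → count P? ≡ 0
count-empty {k} ¬P P? = trans (sum-cong-≗ (λ i → cong (if_then 1 else 0) (dec-false (P? i) (¬P i))))
  (trans (sum-const k 0) (ℕ.*-zeroʳ k))

count-≟ : (a : Fin k) → count (_≟ a) ≡ 1
count-≟ {suc k} zero = cong suc (count-empty (λ _ ()) (λ (i : Fin k) → suc i ≟ zero))
count-≟ {suc k} (suc a) = count-≟ a

count-unique : ∀ a → P a → (∀ {i} → P i → i ≡ a) → (P? : Decidable P) → count P? ≡ 1
count-unique a Pa unique P? =
  trans (count-cong (λ i → mk⇔ unique (λ { refl → Pa })) P? (_≟ a)) (count-≟ a)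

count-all-but-one : P ⊆ Q → ∀ a → Q a → ¬ P a → (∀ {i} → Q i → ¬ P i → i ≡ a) →
  (P? : Decidable P) (Q? : Decidable Q) → count P? ℕ.+ 1 ≡ count Q?
count-all-but-one P⊆Q a Qa ¬Pa unique P? Q? = begin
  count P? ℕ.+ 1                                      ≡⟨ cong (count P? ℕ.+_) (count-≟ a) ⟨
  count P? ℕ.+ count (_≟ a)                           ≡⟨ ∑-distrib-+ (indicator ∘ P?) (indicator ∘ (_≟ a)) ⟨
  sum (λ i → indicator (P? i) ℕ.+ indicator (i ≟ a))  ≡⟨ sum-cong-≗ pointwise ⟩
  count Q?                                            ∎
  where
  open ≡-Reasoning
  pointwise : ∀ i → indicator (P? i) ℕ.+ indicator (i ≟ a) ≡ indicator (Q? i)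
  pointwise i with P? i | Q? i | i ≟ a
  ... | yes Pi | _      | yes refl = ⊥-elim (¬Pa Pi)
  ... | yes Pi | no ¬Qi | _        = ⊥-elim (¬Qi (P⊆Q Pi))
  ... | yes _  | yes _  | no _     = refl
  ... | no _   | yes _  | yes refl = refl
  ... | no ¬Pi | yes Qi | no i≢a   = ⊥-elim (i≢a (unique Qi ¬Pi))
  ... | no _   | no ¬Qa | yes refl = ⊥-elim (¬Qa Qa)
  ... | no _   | no _   | no _     = refl

_∈?_ : (i : Fin k) (l : List (Fin k)) → Dec (i ∈ l)
_∈?_ = DecMembership._∈?_ _≟_

count-∈ : {l : List (Fin k)} → Unique l → count (_∈? l) ≡ length l
count-∈ {k} {[]} [] = count-empty (λ _ ()) (λ (i : Fin k) → i ∈? [])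
count-∈ {l = a ∷ l} (a∉l ∷ unique) = begin
  count (_∈? (a ∷ l))  ≡⟨ count-all-but-one there a (here refl) a∉l′ here-or-in-l (_∈? l) (_∈? (a ∷ l)) ⟨
  count (_∈? l) ℕ.+ 1  ≡⟨ ℕ.+-comm _ 1 ⟩
  suc (count (_∈? l))  ≡⟨ cong suc (count-∈ unique) ⟩
  suc (length l)       ∎
  where
  open ≡-Reasoning
  a∉l′ : ¬ a ∈ l
  a∉l′ a∈l = All.lookup a∉l a∈l refl
  here-or-in-l : ∀ {i} → i ∈ a ∷ l → ¬ i ∈ l → i ≡ a
  here-or-in-l (here i≡a) _ = i≡a
  here-or-in-l (there i∈l) i∉l = ⊥-elim (i∉l i∈l)

hasCard⇒decidable : HasCard P c → Decidable P
hasCard⇒decidable (l , _ , ∈⇔P , _) i = map (∈⇔P i) (i ∈? l)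

count-hasCard : HasCard P c → (P? : Decidable P) → count P? ≡ c
count-hasCard (l , unique , ∈⇔P , length≡c) P? = begin
  count P?        ≡⟨ count-cong ∈⇔P (_∈? l) P? ⟨
  count (_∈? l)   ≡⟨ count-∈ unique ⟩
  length l        ≡⟨ length≡c ⟩
  _               ∎
  where open ≡-Reasoning

guarded? : ∀ b → (b ≡ true → Decidable P) → Decidable (λ i → b ≡ true × P i)
guarded? true P? i = map′ (refl ,_) proj₂ (P? refl i)
guarded? false _ i = no λ { (() , _) }

count-guarded : ∀ b → (b ≡ true → HasCard P c) → (Q? : Decidable (λ i → b ≡ true × P i)) →
  count Q? ≡ (if b then c else 0)
-- map′ keeps the does-component, so the decider handed to count-hasCard counts Q? itself.
count-guarded true hasCard Q? = count-hasCard (hasCard refl) (λ i → map′ proj₂ (refl ,_) (Q? i))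
count-guarded false _ Q? = count-empty (λ _ → λ { (() , _) }) Q?

/-cross : ∀ a b c d → a ℕ.* suc d ≡ b ℕ.* suc c → (+ a) / suc c ≡ (+ b) / suc d
/-cross a b c d eq = ℚ.fromℚᵘ-cong {mkℚᵘ (+ a) c} {mkℚᵘ (+ b) d} (*≡* (begin
  + a ℤ.* + suc d  ≡⟨ ℤ.pos-* a (suc d) ⟨
  + (a ℕ.* suc d)  ≡⟨ cong +_ eq ⟩
  + (b ℕ.* suc c)  ≡⟨ ℤ.pos-* b (suc c) ⟩
  + b ℤ.* + suc c  ∎))
  where open ≡-Reasoning

/-distribʳ-+ : ∀ a b n → (+ (a ℕ.+ b)) / suc n ≡ (+ a) / suc n + (+ b) / suc n
/-distribʳ-+ a b n = ℚ.toℚᵘ-injective (begin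
  ℚ.toℚᵘ ((+ (a ℕ.+ b)) / suc n)
    ≈⟨ ℚ.toℚᵘ-fromℚᵘ (mkℚᵘ (+ (a ℕ.+ b)) n) ⟩
  mkℚᵘ (+ (a ℕ.+ b)) n
    ≈⟨ *≡* cross-multiplied ⟩
  mkℚᵘ (+ a) n ℚᵘ.+ mkℚᵘ (+ b) n
    ≈⟨ ℚᵘ.+-cong (ℚ.toℚᵘ-fromℚᵘ (mkℚᵘ (+ a) n)) (ℚ.toℚᵘ-fromℚᵘ (mkℚᵘ (+ b) n)) ⟨
  ℚ.toℚᵘ ((+ a) / suc n) ℚᵘ.+ ℚ.toℚᵘ ((+ b) / suc n)
    ≈⟨ ℚ.toℚᵘ-homo-+ ((+ a) / suc n) ((+ b) / suc n) ⟨
  ℚ.toℚᵘ ((+ a) / suc n + (+ b) / suc n)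
    ∎)
  where
  open ℚᵘ.≃-Reasoning
  distrib : ∀ (x y z : ℤ) → (x ℤ.+ y) ℤ.* (z ℤ.* z) ≡ (x ℤ.* z ℤ.+ y ℤ.* z) ℤ.* z
  distrib = ℤ.solve-∀
  cross-multiplied : + (a ℕ.+ b) ℤ.* (+ suc n ℤ.* + suc n) ≡ (+ a ℤ.* + suc n ℤ.+ + b ℤ.* + suc n) ℤ.* + suc n
  cross-multiplied = trans (cong (ℤ._* (+ suc n ℤ.* + suc n)) (ℤ.pos-+ a b)) (distrib (+ a) (+ b) (+ suc n))

n/n≡1 : ∀ n → (+ suc n) / suc n ≡ 1ℚ
n/n≡1 n = /-cross (suc n) 1 n 0 (ℕ.*-comm (suc n) 1)

[n*d]/n≡d : ∀ n d → (+ (suc n ℕ.* d)) / suc n ≡ (+ d) / 1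
[n*d]/n≡d n d = /-cross (suc n ℕ.* d) d n 0 (commute (suc n) d)
  where
  commute : ∀ m d → m ℕ.* d ℕ.* 1 ≡ d ℕ.* m
  commute = solve-∀

sumℚ-if-/ : ∀ n (b : Fin k → Bool) (f : Fin k → ℕ) →
  sumℚ (λ i → if b i then (+ f i) / suc n else 0ℚ) ≡ (+ sumℕ (λ i → if b i then f i else 0)) / suc n
sumℚ-if-/ {zero} n b f = sym (ℚ.0/n≡0 (suc n))
sumℚ-if-/ {suc k} n b f = trans
  (cong₂ _+_ (if-/ (b zero)) (sumℚ-if-/ n (b ∘ suc) (f ∘ suc)))
  (sym (/-distribʳ-+ (if b zero then f zero else 0) _ n))
  where
  if-/ : ∀ b → (if b then (+ f zero) / suc n else 0ℚ) ≡ (+ (if b then f zero else 0)) / suc n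
  if-/ true = refl
  if-/ false = sym (ℚ.0/n≡0 (suc n))

fraction-shift : ∀ a d n → a ℕ.+ suc n ≡ suc n ℕ.* d ℕ.+ 1 →
  (+ a) / suc n ≡ ((+ d) / 1 - 1ℚ) + (+ 1) / suc n
fraction-shift a d n eq = begin
  x                                                ≡⟨ solve 1 (λ x → x := (x :+ con 1ℚ) :- con 1ℚ) refl x ⟩
  (x + 1ℚ) - 1ℚ                                    ≡⟨ cong (_- 1ℚ) shifted ⟩
  ((+ d) / 1 + (+ 1) / suc n) - 1ℚ                 ≡⟨ solve 2 (λ y z → (y :+ z) :- con 1ℚ := (y :- con 1ℚ) :+ z) refl ((+ d) / 1) ((+ 1) / suc n) ⟩
  ((+ d) / 1 - 1ℚ) + (+ 1) / suc n                 ∎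
  where
  open ≡-Reasoning
  open +-*-Solver
  x = (+ a) / suc n
  shifted : x + 1ℚ ≡ (+ d) / 1 + (+ 1) / suc n
  shifted = begin
    x + 1ℚ                                         ≡⟨ cong (λ y → x + y) (n/n≡1 n) ⟨
    x + (+ suc n) / suc n                          ≡⟨ /-distribʳ-+ a (suc n) n ⟨
    (+ (a ℕ.+ suc n)) / suc n                      ≡⟨ cong (λ t → (+ t) / suc n) eq ⟩
    (+ (suc n ℕ.* d ℕ.+ 1)) / suc n                ≡⟨ /-distribʳ-+ (suc n ℕ.* d) 1 n ⟩
    (+ (suc n ℕ.* d)) / suc n + (+ 1) / suc n      ≡⟨ cong (_+ (+ 1) / suc n) ([n*d]/n≡d n d) ⟩
    (+ d) / 1 + (+ 1) / suc n                      ∎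

module _ {m n : ℕ} where

  Adj-sym : {H : BGraph m n} {x y : Vtx m n} → Adj H x y → Adj H y x
  Adj-sym (ve v e h) = ev v e h
  Adj-sym (ev v e h) = ve v e h

  Reach-sym : {H : BGraph m n} {x y : Vtx m n} → Reach H x y → Reach H y x
  Reach-sym = reverse Adj-sym

  removeEdge-keeps : (H : BGraph m n) {v v′ : Fin m} {e e′ : Fin n} →
    H v′ e′ ≡ true → v′ ≢ v ⊎ e′ ≢ e → removeEdge H v e v′ e′ ≡ true
  removeEdge-keeps H {v} {v′} {e} {e′} h other rewrite h with v′ ≟ v | e′ ≟ e | other
  ... | no _     | _        | _         = refl
  ... | yes _    | no _     | _         = refl
  ... | yes v′≡v | yes _    | inj₁ v′≢v = ⊥-elim (v′≢v v′≡v)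
  ... | yes _    | yes e′≡e | inj₂ e′≢e = ⊥-elim (e′≢e e′≡e)

  AdjAvoiding : BGraph m n → Vtx m n → Rel (Vtx m n) 0ℓ
  AdjAvoiding H z x y = Adj H x y × x ≢ z × y ≢ z

  avoiding-start : {H : BGraph m n} {z a x : Vtx m n} → Star (AdjAvoiding H z) a x → x ≢ z → a ≢ z
  avoiding-start ε x≢z = x≢z
  avoiding-start ((_ , a≢z , _) ◅ _) _ = a≢z

  last-exit : {H : BGraph m n} {z a x : Vtx m n} → x ≢ z → Reach H a x →
    Star (AdjAvoiding H z) a x ⊎ ∃[ y ] Adj H z y × Star (AdjAvoiding H z) y x
  last-exit x≢z ε = inj₁ ε
  last-exit {z = z} {a} x≢z (step ◅ walk) with last-exit x≢z walk
  ... | inj₂ found = inj₂ found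
  ... | inj₁ avoiding with ≡-dec _≟_ _≟_ a z
  ...   | yes refl = inj₂ (_ , step , avoiding)
  ...   | no a≢z = inj₁ ((step , a≢z , avoiding-start avoiding x≢z) ◅ avoiding)

  exit : {H : BGraph m n} {z x : Vtx m n} → x ≢ z → Reach H z x →
    ∃[ y ] Adj H z y × Star (AdjAvoiding H z) y x
  exit x≢z walk with last-exit x≢z walk
  ... | inj₁ avoiding = ⊥-elim (avoiding-start avoiding x≢z refl)
  ... | inj₂ found = found

  avoiding⊆removeEdge : {H : BGraph m n} {v : Fin m} {e : Fin n} {z x y : Vtx m n} →
    z ≡ inj₁ v ⊎ z ≡ inj₂ e → AdjAvoiding H z x y → Adj (removeEdge H v e) x y
  avoiding⊆removeEdge {H} (inj₁ refl) (ve v′ e′ h , v′≢v , _) = ve v′ e′ (removeEdge-keeps H h (inj₁ (v′≢v ∘ cong inj₁)))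
  avoiding⊆removeEdge {H} (inj₁ refl) (ev v′ e′ h , _ , v′≢v) = ev v′ e′ (removeEdge-keeps H h (inj₁ (v′≢v ∘ cong inj₁)))
  avoiding⊆removeEdge {H} (inj₂ refl) (ve v′ e′ h , _ , e′≢e) = ve v′ e′ (removeEdge-keeps H h (inj₂ (e′≢e ∘ cong inj₂)))
  avoiding⊆removeEdge {H} (inj₂ refl) (ev v′ e′ h , e′≢e , _) = ev v′ e′ (removeEdge-keeps H h (inj₂ (e′≢e ∘ cong inj₂)))

  avoiding⇒removeEdge : {H : BGraph m n} {v : Fin m} {e : Fin n} {z x y : Vtx m n} →
    z ≡ inj₁ v ⊎ z ≡ inj₂ e → Star (AdjAvoiding H z) x y → Reach (removeEdge H v e) x y
  avoiding⇒removeEdge endpoint = mapStar (avoiding⊆removeEdge endpoint)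

  -- The elements of E counted by the weight w(ve).
  Branch : BGraph m n → Fin m → Fin n → Pred (Fin n) 0ℓ
  Branch H v e x = H v e ≡ true × Reach (removeEdge H v e) (inj₂ e) (inj₂ x)

module Tree {m n : ℕ} {Γ : BGraph m n} (connected : Connected Γ)
  (bridge : ∀ v e → Γ v e ≡ true → ¬ Reach (removeEdge Γ v e) (inj₁ v) (inj₂ e))
  (cnt : Fin m → Fin n → ℕ)
  (hasCard : ∀ v e → Γ v e ≡ true →
    HasCard (λ x → Reach (removeEdge Γ v e) (inj₂ e) (inj₂ x)) (cnt v e)) where

  branch? : ∀ v e → Decidable (Branch Γ v e)
  branch? v e = guarded? (Γ v e) (hasCard⇒decidable ∘ hasCard v e)

  branch-size : ∀ v e → (if Γ v e then cnt v e else 0) ≡ count (branch? v e)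
  branch-size v e = sym (count-guarded (Γ v e) (hasCard v e) (branch? v e))

  -- does (edge? e v) reduces to Γ v e, so degE Γ e is count (edge? e) up to sumℕ≡sum.
  edge? : ∀ e → Decidable (λ v → Γ v e ≡ true)
  edge? e v = map T-≡ (T? (Γ v e))

  separated : ∀ {v e y} → Γ v e ≡ true → Reach (removeEdge Γ v e) (inj₁ v) y →
    ¬ Reach (removeEdge Γ v e) (inj₂ e) y
  separated h v⇝y e⇝y = bridge _ _ h (v⇝y ◅◅ Reach-sym e⇝y)

  count-branches-at-V : ∀ v x → count (λ e → branch? v e x) ≡ 1
  count-branches-at-V v x with exit {z = inj₁ v} (λ ()) (connected (inj₁ v) (inj₂ x))
  ... | _ , ve _ e₀ h₀ , e₀⇝x =
    count-unique e₀ (h₀ , avoiding⇒removeEdge (inj₁ refl) e₀⇝x) only-e₀ (λ e → branch? v e x)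
    where
    only-e₀ : ∀ {e} → Branch Γ v e x → e ≡ e₀
    only-e₀ {e} (h , e⇝x) with e ≟ e₀
    ... | yes e≡e₀ = e≡e₀
    ... | no e≢e₀ = ⊥-elim (separated h
      (ve v e₀ (removeEdge-keeps Γ h₀ (inj₂ (e≢e₀ ∘ sym))) ◅ avoiding⇒removeEdge (inj₁ refl) e₀⇝x) e⇝x)

  count-branches-at-E : ∀ e x → count (λ v → branch? v e x) ℕ.+ 1 ≡ count (edge? e) ℕ.+ indicator (x ≟ e)
  count-branches-at-E e x with x ≟ e
  ... | yes refl = cong (ℕ._+ 1) (count-cong (λ v → mk⇔ proj₁ (_, ε)) (λ v → branch? v e e) (edge? e))
  ... | no x≢e with exit {z = inj₂ e} (x≢e ∘ inj₂-injective) (connected (inj₂ e) (inj₂ x))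
  ...   | _ , ev v₀ _ h₀ , v₀⇝x =
    trans (count-all-but-one proj₁ v₀ h₀ v₀-cut only-v₀ (λ v → branch? v e x) (edge? e)) (sym (ℕ.+-identityʳ _))
    where
    v₀-cut : ¬ Branch Γ v₀ e x
    v₀-cut (_ , e⇝x) = separated h₀ (avoiding⇒removeEdge (inj₂ refl) v₀⇝x) e⇝x
    only-v₀ : ∀ {v} → Γ v e ≡ true → ¬ Branch Γ v e x → v ≡ v₀
    only-v₀ {v} h v-cut with v ≟ v₀
    ... | yes v≡v₀ = v≡v₀
    ... | no v≢v₀ = ⊥-elim (v-cut (h ,
      ev v₀ e (removeEdge-keeps Γ h₀ (inj₁ (v≢v₀ ∘ sym))) ◅ avoiding⇒removeEdge (inj₂ refl) v₀⇝x))

  sum-branch-sizes-at-V : ∀ v → sumℕ (λ e → if Γ v e then cnt v e else 0) ≡ n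
  sum-branch-sizes-at-V v = begin
    sumℕ (λ e → if Γ v e then cnt v e else 0)  ≡⟨ sumℕ≡sum (λ e → if Γ v e then cnt v e else 0) ⟩
    sum (λ e → if Γ v e then cnt v e else 0)   ≡⟨ sum-cong-≗ (branch-size v) ⟩
    sum (λ e → count (branch? v e))            ≡⟨ ∑-comm (λ e x → indicator (branch? v e x)) ⟩
    sum (λ x → count (λ e → branch? v e x))    ≡⟨ sum-cong-≗ (count-branches-at-V v) ⟩
    sum {n} (λ _ → 1)                          ≡⟨ sum-const n 1 ⟩
    n ℕ.* 1                                    ≡⟨ ℕ.*-identityʳ n ⟩
    n                                          ∎
    where open ≡-Reasoning

  sum-branch-sizes-at-E : ∀ e → sumℕ (λ v → if Γ v e then cnt v e else 0) ℕ.+ n ≡ n ℕ.* degE Γ e ℕ.+ 1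
  sum-branch-sizes-at-E e = begin
    sumℕ (λ v → if Γ v e then cnt v e else 0) ℕ.+ n
      ≡⟨ cong (ℕ._+ n) (sumℕ≡sum (λ v → if Γ v e then cnt v e else 0)) ⟩
    sum (λ v → if Γ v e then cnt v e else 0) ℕ.+ n
      ≡⟨ cong (ℕ._+ n) (sum-cong-≗ (λ v → branch-size v e)) ⟩
    sum (λ v → count (branch? v e)) ℕ.+ n
      ≡⟨ cong₂ ℕ._+_ (∑-comm (λ v x → indicator (branch? v e x))) (sym (trans (sum-const n 1) (ℕ.*-identityʳ n))) ⟩
    sum (λ x → count (λ v → branch? v e x)) ℕ.+ sum {n} (λ _ → 1)
      ≡⟨ ∑-distrib-+ (λ x → count (λ v → branch? v e x)) (λ _ → 1) ⟨
    sum (λ x → count (λ v → branch? v e x) ℕ.+ 1)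
      ≡⟨ sum-cong-≗ (count-branches-at-E e) ⟩
    sum (λ x → count (edge? e) ℕ.+ indicator (x ≟ e))
      ≡⟨ ∑-distrib-+ (λ _ → count (edge? e)) (λ x → indicator (x ≟ e)) ⟩
    sum {n} (λ _ → count (edge? e)) ℕ.+ count (_≟ e)
      ≡⟨ cong₂ ℕ._+_ (sum-const n (count (edge? e))) (count-≟ e) ⟩
    n ℕ.* count (edge? e) ℕ.+ 1
      ≡⟨ cong (λ d → n ℕ.* d ℕ.+ 1) (sumℕ≡sum (λ v → if Γ v e then 1 else 0)) ⟨
    n ℕ.* degE Γ e ℕ.+ 1
      ∎
    where open ≡-Reasoning

lemma3p14 : (m n : ℕ) → .{{_ : NonZero n}} → (G Γ : BGraph m n) →
    Connected G → SpanningTree Γ G →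
    (cnt : Fin m → Fin n → ℕ) →
    (∀ v e → Γ v e ≡ true →
      HasCard (λ e′ → Reach (removeEdge Γ v e) (inj₂ e) (inj₂ e′)) (cnt v e)) →
    let w : Fin m → Fin n → ℚ
        w v e = (+ cnt v e) / n
    in (∀ v e → Γ v e ≡ true → 0ℚ ≤ w v e)
       × (∀ v → sumℚ (λ e → if Γ v e then w v e else 0ℚ) ≡ 1ℚ)
       × (∀ e → sumℚ (λ v → if Γ v e then w v e else 0ℚ)
                ≡ ((+ degE Γ e) / 1 - 1ℚ) + (+ 1) / n)
lemma3p14 m zero {{()}} _ _ _ _ _ _
lemma3p14 m (suc n) _ Γ _ (_ , connected , bridge) cnt hasCard = nonnegative , sum-at-V , sum-at-E
  where
  open Tree connected bridge cnt hasCard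
  open ≡-Reasoning

  nonnegative : ∀ v e → Γ v e ≡ true → 0ℚ ≤ (+ cnt v e) / suc n
  nonnegative v e _ = ℚ.nonNegative⁻¹ _ {{ℚ.normalize-nonNeg (cnt v e) (suc n)}}

  sum-at-V : ∀ v → sumℚ (λ e → if Γ v e then (+ cnt v e) / suc n else 0ℚ) ≡ 1ℚ
  sum-at-V v = begin
    sumℚ (λ e → if Γ v e then (+ cnt v e) / suc n else 0ℚ)  ≡⟨ sumℚ-if-/ n (Γ v) (cnt v) ⟩
    (+ sumℕ (λ e → if Γ v e then cnt v e else 0)) / suc n    ≡⟨ cong (λ t → (+ t) / suc n) (sum-branch-sizes-at-V v) ⟩
    (+ suc n) / suc n                                         ≡⟨ n/n≡1 n ⟩
    1ℚ                                                        ∎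

  sum-at-E : ∀ e → sumℚ (λ v → if Γ v e then (+ cnt v e) / suc n else 0ℚ)
                   ≡ ((+ degE Γ e) / 1 - 1ℚ) + (+ 1) / suc n
  sum-at-E e = trans (sumℚ-if-/ n (λ v → Γ v e) (λ v → cnt v e))
                     (fraction-shift _ _ n (sum-branch-sizes-at-E e))
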